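{- Let $n \ge 3$, $2 \le k \le n-1$ and $b \ge 1$ be integers, let $G = T(n,(k,b))$ and $t(v_i) = t(G, v_i, v_n)$. Then \[ t(v_i) = \begin{cases} n^2 - k^2 + 2(b-1)(n-k) + (k-1)^2 - (i-1)^2, & 1 \le i \le k-1,\\ n^2 - i^2 + 2(b-1)(n-i), & k \le i \le n-1. \end{cases} \]
   Context: $T(n,(k,b))$ is the tree consisting of a path (spine) $v_1 v_2 \cdots v_n$ together with $b$ leaves $u_1,\ldots,u_b$, each adjacent only to the spine vertex $v_k$. $t(G,v,u)$ denotes the expected number of steps until a simple random walk on $G$ started at $v$ (moving each step to a uniformly random neighbor) first reaches $u$. -}

module Defs where

open import Data.Bool using (Bool; true; false; if_then_else_; _∧_; _∨_)
open import Data.Nat as ℕ using (ℕ; zero; suc; _≡ᵇ_; _<ᵇ_; _≤ᵇ_; _∸_)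
open import Data.Fin using (Fin; toℕ)
import Data.Fin as F
open import Data.Integer as ℤ using (ℤ; +_)
open import Data.Rational using (ℚ; 0ℚ; 1ℚ; _/_; _+_; _*_; _-_; _<_; ∣_∣)
open import Data.Product using (∃)

sumFin : (N : ℕ) → (Fin N → ℚ) → ℚ
sumFin zero    f = 0ℚ
sumFin (suc N) f = f F.zero + sumFin N (λ x → f (F.suc x))

sumTo : ℕ → (ℕ → ℚ) → ℚ
sumTo zero    f = 0ℚ
sumTo (suc m) f = sumTo m f + f m

-- A finite graph on vertex set {0,…,N-1} (encoded as naturals < N),
-- given by a Boolean adjacency relation.
count : (N : ℕ) → (Fin N → Bool) → ℕ
count zero    p = 0
count (suc N) p = (if p F.zero then 1 else 0) ℕ.+ count N (λ x → p (F.suc x))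

deg : (N : ℕ) → (ℕ → ℕ → Bool) → ℕ → ℕ
deg N adj x = count N (λ y → adj x (toℕ y))

-- transition probability weight 1/deg(x) (0 if x is isolated; then unused)
invDeg : ℕ → ℚ
invDeg zero    = 0ℚ
invDeg (suc d) = + 1 / suc d

-- walkDist N adj v u t y = P(X_t = y and the walk started at v has not
-- visited u before time t). Mass arriving at u is absorbed (not moved on).
walkDist : (N : ℕ) → (ℕ → ℕ → Bool) → (v u : ℕ) → ℕ → Fin N → ℚ
walkDist N adj v u zero    y = if toℕ y ≡ᵇ v then 1ℚ else 0ℚ
walkDist N adj v u (suc t) y =
  sumFin N (λ x → if toℕ x ≡ᵇ u then 0ℚ
                  else (if adj (toℕ x) (toℕ y)
                        then walkDist N adj v u t x * invDeg (deg N adj (toℕ x))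
                        else 0ℚ))

-- P(T_u = t) where T_u is the first hitting time of u from v.
hitProb : (N : ℕ) → (ℕ → ℕ → Bool) → (v u : ℕ) → ℕ → ℚ
hitProb N adj v u t =
  sumFin N (λ x → if toℕ x ≡ᵇ u then walkDist N adj v u t x else 0ℚ)

ℕ→ℚ : ℕ → ℚ
ℕ→ℚ m = + m / 1

expPartial : (N : ℕ) → (ℕ → ℕ → Bool) → (v u : ℕ) → ℕ → ℚ
expPartial N adj v u m = sumTo m (λ t → ℕ→ℚ t * hitProb N adj v u t)

-- t(G,v,u) = h : the series Σ_t t·P(T_u = t) converges to h.
HittingTimeIs : (N : ℕ) → (ℕ → ℕ → Bool) → (v u : ℕ) → ℚ → Set
HittingTimeIs N adj v u h =
  ∀ (ε : ℚ) → 0ℚ < ε → ∃ λ M → ∀ m → M ℕ.≤ m → ∣ expPartial N adj v u m - h ∣ < ε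

-- T(n,(k,b)) on vertices 0,…,n+b-1: spine v_i is index i-1 (1 ≤ i ≤ n),
-- leaves u_1,…,u_b are indices n,…,n+b-1, each adjacent to v_k (index k-1).
Tsize : ℕ → ℕ → ℕ
Tsize n b = n ℕ.+ b

spineEdge : ℕ → ℕ → ℕ → Bool
spineEdge n x y = (suc x ≡ᵇ y) ∧ (y <ᵇ n)

leafEdge : ℕ → ℕ → ℕ → ℕ → ℕ → Bool
leafEdge n k b x y = (x ≡ᵇ (k ∸ 1)) ∧ ((n ≤ᵇ y) ∧ (y <ᵇ (n ℕ.+ b)))

Tadj : (n k b : ℕ) → ℕ → ℕ → Bool
Tadj n k b x y = spineEdge n x y ∨ spineEdge n y x ∨ leafEdge n k b x y ∨ leafEdge n k b y x

spine : ℕ → ℕ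
spine i = i ∸ 1

ℤ→ℚ : ℤ → ℚ
ℤ→ℚ z = z / 1

-- Let φ vanish at the target v_n and satisfy the first-step equations
-- φ(x) = 1 + (mean of φ over the neighbours of x) at every other vertex.  For the walk
-- from v killed at v_n let S_t be the surviving mass, H_t = P(T = t) and Φ_t the expected
-- value of φ over the survivors.  The first-step equations give Φ_{t+1} = Φ_t − S_t, hence
-- Σ_{s ≤ t} s H_s + t S_t + Φ_t = φ(v).  As S is non-increasing and 0 ≤ Φ ≤ F S, the
-- remainder t S_t + Φ_t is at most 2F²/a at t = 2a, so the first moments converge to φ(v).
--
-- On T(n,(k,b)) the solution is φ(v_i) = Σ_{i ≤ l < n} c_l, where c_l = 2e_l + 1 is the
-- expected time to step from v_l to v_{l+1} and e_l counts the edges on the v_l side of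
-- that edge (l − 1, plus b once l ≥ k); at a leaf φ = 1 + φ(v_k).  The sum telescopes to
-- the two closed forms.

module Submission where

open import Defs
open import Data.Bool using (Bool)
open import Data.Fin using (Fin; toℕ)
open import Data.Nat as ℕ using (ℕ; suc)
open import Data.Rational as ℚ using (ℚ; 0ℚ; 1ℚ)
open import Relation.Binary.PropositionalEquality using (_≡_; _≢_)

module BooleanTests where

  open import Data.Bool using (true; false; T)
  open import Data.Nat using (ℕ; _≡ᵇ_; _<ᵇ_; _≤ᵇ_; _≟_; _<?_; _≤?_; _<_; _≤_)
  open import Data.Nat.Properties using (≡ᵇ⇒≡; ≤⇒≯; <⇒≱)
  open import Relation.Binary.PropositionalEquality using (refl; sym; trans; subst)
  open import Relation.Nullary.Decidable using (dec-true; dec-false)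

  ≡ᵇ-refl : ∀ n → (n ≡ᵇ n) ≡ true
  ≡ᵇ-refl n = dec-true (n ≟ n) refl

  ≡ᵇ-false : ∀ {m n} → m ≢ n → (m ≡ᵇ n) ≡ false
  ≡ᵇ-false {m} {n} = dec-false (m ≟ n)

  ≡ᵇ-true⇒≡ : ∀ {m n} → (m ≡ᵇ n) ≡ true → m ≡ n
  ≡ᵇ-true⇒≡ {m} {n} e = ≡ᵇ⇒≡ m n (subst T (sym e) _)

  ≡ᵇ-false⇒≢ : ∀ {m n} → (m ≡ᵇ n) ≡ false → m ≢ n
  ≡ᵇ-false⇒≢ {m} e refl with () ← trans (sym e) (≡ᵇ-refl m)

  <ᵇ-true : ∀ {m n} → m < n → (m <ᵇ n) ≡ true
  <ᵇ-true {m} {n} = dec-true (m <? n)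

  <ᵇ-false : ∀ {m n} → n ≤ m → (m <ᵇ n) ≡ false
  <ᵇ-false {m} {n} n≤m = dec-false (m <? n) (≤⇒≯ n≤m)

  ≤ᵇ-true : ∀ {m n} → m ≤ n → (m ≤ᵇ n) ≡ true
  ≤ᵇ-true {m} {n} = dec-true (m ≤? n)

  ≤ᵇ-false : ∀ {m n} → n < m → (m ≤ᵇ n) ≡ false
  ≤ᵇ-false {m} {n} n<m = dec-false (m ≤? n) (<⇒≱ n<m)

module Rationals where

  open import Data.Bool using (true; false; if_then_else_)
  open import Data.Integer as ℤ using (+_)
  import Data.Integer.Properties as ℤ
  open import Data.Maybe using (Maybe; just; nothing)
  open import Data.Nat as ℕ using (ℕ; zero; suc; z≤n; s≤s)
  import Data.Nat.Coprimality as Coprime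
  import Data.Nat.Properties as ℕ
  open import Data.Product using (∃; _,_)
  open import Data.Rational
    using (ℚ; 0ℚ; 1ℚ; mkℚ; _+_; _*_; _-_; -_; _≤_; _<_; ∣_∣; *≤*; *<*; nonNegative)
  open import Data.Rational.Properties
  open import Level using (0ℓ)
  open import Relation.Binary.PropositionalEquality
  open import Relation.Nullary using (yes; no; contradiction)
  open import Tactic.RingSolver using (solve-∀)
  open import Tactic.RingSolver.Core.AlmostCommutativeRing using (AlmostCommutativeRing; fromCommutativeRing)

  ℚ-ring : AlmostCommutativeRing 0ℓ 0ℓ
  ℚ-ring = fromCommutativeRing +-*-commutativeRing isZero
    where
    isZero : ∀ x → Maybe (0ℚ ≡ x)
    isZero x with x ≟ 0ℚ
    ... | yes x≡0 = just (sym x≡0)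
    ... | no _    = nothing

  -- z / 1 does not reduce for a variable z; exposing the normal form makes ℤ→ℚ and invDeg compute.
  ℤ→ℚ≡mkℚ : ∀ z → ℤ→ℚ z ≡ mkℚ z 0 (Coprime.sym (Coprime.1-coprimeTo ℤ.∣ z ∣))
  ℤ→ℚ≡mkℚ z = ↥p/↧p≡p (mkℚ z 0 (Coprime.sym (Coprime.1-coprimeTo ℤ.∣ z ∣)))

  ℤ→ℚ-+ : ∀ a b → ℤ→ℚ (a ℤ.+ b) ≡ ℤ→ℚ a + ℤ→ℚ b
  ℤ→ℚ-+ a b = begin
    ℤ→ℚ (a ℤ.+ b)                     ≡⟨ cong₂ (λ x y → ℤ→ℚ (x ℤ.+ y)) (ℤ.*-identityʳ a) (ℤ.*-identityʳ b) ⟨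
    ℤ→ℚ (a ℤ.* + 1 ℤ.+ b ℤ.* + 1)     ≡⟨ cong₂ _+_ (ℤ→ℚ≡mkℚ a) (ℤ→ℚ≡mkℚ b) ⟨
    ℤ→ℚ a + ℤ→ℚ b                     ∎
    where open ≡-Reasoning

  ℤ→ℚ-* : ∀ a b → ℤ→ℚ (a ℤ.* b) ≡ ℤ→ℚ a * ℤ→ℚ b
  ℤ→ℚ-* a b rewrite ℤ→ℚ≡mkℚ a | ℤ→ℚ≡mkℚ b = refl

  ℕ→ℚ-+ : ∀ m n → ℕ→ℚ (m ℕ.+ n) ≡ ℕ→ℚ m + ℕ→ℚ n
  ℕ→ℚ-+ m n = ℤ→ℚ-+ (+ m) (+ n)

  ℕ→ℚ-* : ∀ m n → ℕ→ℚ (m ℕ.* n) ≡ ℕ→ℚ m * ℕ→ℚ n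
  ℕ→ℚ-* m n = trans (cong ℤ→ℚ (ℤ.pos-* m n)) (ℤ→ℚ-* (+ m) (+ n))

  ℕ→ℚ-mono-≤ : ∀ {m n} → m ℕ.≤ n → ℕ→ℚ m ≤ ℕ→ℚ n
  ℕ→ℚ-mono-≤ {m} {n} m≤n rewrite ℤ→ℚ≡mkℚ (+ m) | ℤ→ℚ≡mkℚ (+ n) =
    *≤* (subst₂ ℤ._≤_ (sym (ℤ.*-identityʳ (+ m))) (sym (ℤ.*-identityʳ (+ n))) (ℤ.+≤+ m≤n))

  ℕ→ℚ-mono-< : ∀ {m n} → m ℕ.< n → ℕ→ℚ m < ℕ→ℚ n
  ℕ→ℚ-mono-< {m} {n} m<n rewrite ℤ→ℚ≡mkℚ (+ m) | ℤ→ℚ≡mkℚ (+ n) =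
    *<* (subst₂ ℤ._<_ (sym (ℤ.*-identityʳ (+ m))) (sym (ℤ.*-identityʳ (+ n))) (ℤ.+<+ m<n))

  ℕ→ℚ-injective : ∀ {m n} → ℕ→ℚ m ≡ ℕ→ℚ n → m ≡ n
  ℕ→ℚ-injective {m} {n} eq with trans (sym (ℤ→ℚ≡mkℚ (+ m))) (trans eq (ℤ→ℚ≡mkℚ (+ n)))
  ... | refl = refl

  0≤ℕ→ℚ : ∀ n → 0ℚ ≤ ℕ→ℚ n
  0≤ℕ→ℚ n = ℕ→ℚ-mono-≤ {0} {n} z≤n

  invDeg≡mkℚ : ∀ d → invDeg (suc d) ≡ mkℚ (+ 1) d (Coprime.1-coprimeTo (suc d))
  invDeg≡mkℚ d = ↥p/↧p≡p (mkℚ (+ 1) d (Coprime.1-coprimeTo (suc d)))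

  invDeg-inverse : ∀ d → d ≢ 0 → invDeg d * ℕ→ℚ d ≡ 1ℚ
  invDeg-inverse zero    d≢0 = contradiction refl d≢0
  invDeg-inverse (suc d) _ rewrite invDeg≡mkℚ d | ℤ→ℚ≡mkℚ (+ suc d) =
    *-inverseˡ (mkℚ (+ suc d) 0 (Coprime.sym (Coprime.1-coprimeTo (suc d))))

  0≤invDeg : ∀ d → 0ℚ ≤ invDeg d
  0≤invDeg zero    = ≤-refl
  0≤invDeg (suc d) rewrite invDeg≡mkℚ d = *≤* (ℤ.+≤+ z≤n)

  p≤p+q : ∀ p {q} → 0ℚ ≤ q → p ≤ p + q
  p≤p+q p {q} 0≤q = subst (_≤ p + q) (+-identityʳ p) (+-monoʳ-≤ p 0≤q)

  0≤p+q : ∀ {p q} → 0ℚ ≤ p → 0ℚ ≤ q → 0ℚ ≤ p + q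
  0≤p+q {p} 0≤p 0≤q = ≤-trans 0≤p (p≤p+q p 0≤q)

  0≤p*q : ∀ {p q} → 0ℚ ≤ p → 0ℚ ≤ q → 0ℚ ≤ p * q
  0≤p*q {p} {q} 0≤p 0≤q =
    nonNegative⁻¹ (p * q) {{nonNeg*nonNeg⇒nonNeg p {{nonNegative 0≤p}} q {{nonNegative 0≤q}}}}

  0≤if : ∀ b {p q} → 0ℚ ≤ p → 0ℚ ≤ q → 0ℚ ≤ (if b then p else q)
  0≤if true  0≤p _   = 0≤p
  0≤if false _   0≤q = 0≤q

  *-monoˡ-≤-ℕ→ℚ : ∀ c {p q} → p ≤ q → ℕ→ℚ c * p ≤ ℕ→ℚ c * q
  *-monoˡ-≤-ℕ→ℚ c = *-monoˡ-≤-nonNeg (ℕ→ℚ c) {{nonNegative (0≤ℕ→ℚ c)}}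

  archimedean : ∀ C ε → 0ℚ < ε → ∃ λ a → ℕ→ℚ C < ℕ→ℚ a * ε
  archimedean C (mkℚ (+ zero) _ _) (*<* (ℤ.+<+ ()))
  archimedean C ε@(mkℚ (+ suc p) d _) _ = suc C ℕ.* suc d , (begin-strict
    ℕ→ℚ C                                        <⟨ ℕ→ℚ-mono-< (ℕ.n<1+n C) ⟩
    ℕ→ℚ (suc C)                                  ≡⟨ *-identityʳ (ℕ→ℚ (suc C)) ⟨
    ℕ→ℚ (suc C) * 1ℚ                             ≡⟨ cong (_*_ (ℕ→ℚ (suc C))) d*[1/d]≡1 ⟨
    ℕ→ℚ (suc C) * (ℕ→ℚ (suc d) * invDeg (suc d)) ≡⟨ *-assoc (ℕ→ℚ (suc C)) (ℕ→ℚ (suc d)) (invDeg (suc d)) ⟨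
    ℕ→ℚ (suc C) * ℕ→ℚ (suc d) * invDeg (suc d)   ≡⟨ cong (_* invDeg (suc d)) (ℕ→ℚ-* (suc C) (suc d)) ⟨
    ℕ→ℚ (suc C ℕ.* suc d) * invDeg (suc d)       ≤⟨ *-monoˡ-≤-ℕ→ℚ (suc C ℕ.* suc d) 1/[1+d]≤ε ⟩
    ℕ→ℚ (suc C ℕ.* suc d) * ε                    ∎)
    where
    open ≤-Reasoning
    d*[1/d]≡1 : ℕ→ℚ (suc d) * invDeg (suc d) ≡ 1ℚ
    d*[1/d]≡1 = trans (*-comm (ℕ→ℚ (suc d)) (invDeg (suc d))) (invDeg-inverse (suc d) (λ ()))
    1/[1+d]≤ε : invDeg (suc d) ≤ ε
    1/[1+d]≤ε rewrite invDeg≡mkℚ d = *≤* (ℤ.+≤+ (ℕ.*-monoˡ-≤ (suc d) {1} {suc p} (s≤s z≤n)))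

  ∣p-[p+r]∣<ε : ∀ {p q r ε} → p + r ≡ q → 0ℚ ≤ r → r < ε → ∣ p - q ∣ < ε
  ∣p-[p+r]∣<ε {p} {q} {r} refl 0≤r r<ε = begin-strict
    ∣ p - (p + r) ∣ ≡⟨ cong ∣_∣ (p-[p+r]≡-r p r) ⟩
    ∣ - r ∣         ≡⟨ ∣-p∣≡∣p∣ r ⟩
    ∣ r ∣           ≡⟨ 0≤p⇒∣p∣≡p 0≤r ⟩
    r               <⟨ r<ε ⟩
    _               ∎
    where
    open ≤-Reasoning
    p-[p+r]≡-r : ∀ p r → p - (p + r) ≡ - r
    p-[p+r]≡-r = solve-∀ ℚ-ring

  s+d≡d*p⇒s≡d*[p-1] : ∀ {s d p} → s ℕ.+ d ≡ d ℕ.* p → ℕ→ℚ s ≡ ℕ→ℚ d * (ℕ→ℚ p - 1ℚ)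
  s+d≡d*p⇒s≡d*[p-1] {s} {d} {p} s+d≡d*p = begin
    ℕ→ℚ s                          ≡⟨ cancel (ℕ→ℚ s) (ℕ→ℚ d) ⟩
    ℕ→ℚ s + ℕ→ℚ d - ℕ→ℚ d          ≡⟨ cong (_- ℕ→ℚ d) (ℕ→ℚ-+ s d) ⟨
    ℕ→ℚ (s ℕ.+ d) - ℕ→ℚ d          ≡⟨ cong (λ x → ℕ→ℚ x - ℕ→ℚ d) s+d≡d*p ⟩
    ℕ→ℚ (d ℕ.* p) - ℕ→ℚ d          ≡⟨ cong (_- ℕ→ℚ d) (ℕ→ℚ-* d p) ⟩
    ℕ→ℚ d * ℕ→ℚ p - ℕ→ℚ d          ≡⟨ factor (ℕ→ℚ d) (ℕ→ℚ p) ⟩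
    ℕ→ℚ d * (ℕ→ℚ p - 1ℚ)           ∎
    where
    open ≡-Reasoning
    cancel : ∀ s d → s ≡ s + d - d
    cancel = solve-∀ ℚ-ring
    factor : ∀ d p → d * p - d ≡ d * (p - 1ℚ)
    factor = solve-∀ ℚ-ring

  ConvergesTo : (ℕ → ℚ) → ℚ → Set
  ConvergesTo a L = ∀ ε → 0ℚ < ε → ∃ λ M → ∀ m → M ℕ.≤ m → ∣ a m - L ∣ < ε

module Sums where

  open BooleanTests
  open Rationals using (ℕ→ℚ-+)
  open import Algebra.Bundles using (Ring)
  open import Data.Bool using (if_then_else_)
  open import Data.Bool.Properties using (if-float)
  open import Data.Fin as Fin using (Fin; toℕ)
  open import Data.Nat as ℕ using (ℕ; zero; suc; _≡ᵇ_)
  import Data.Nat.Properties as ℕ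
  open import Data.Rational using (ℚ; 0ℚ; 1ℚ; _+_; _*_; _≤_)
  open import Data.Rational.Properties
  open import Data.Sum using (inj₁; inj₂)
  open import Relation.Binary.PropositionalEquality

  open import Algebra.Properties.Semiring.Sum (Ring.semiring +-*-ring) public
    using (sum; sum-syntax; sum-cong-≗; sum-replicate-zero; ∑-distrib-+; ∑-comm; *-distribˡ-sum; *-distribʳ-sum)

  sumFin≡∑ : ∀ N (f : Fin N → ℚ) → sumFin N f ≡ ∑[ i < N ] f i
  sumFin≡∑ zero    f = refl
  sumFin≡∑ (suc N) f = cong (_+_ (f Fin.zero)) (sumFin≡∑ N (λ i → f (Fin.suc i)))

  ∑-mono : ∀ {N} {f g : Fin N → ℚ} → (∀ i → f i ≤ g i) → ∑[ i < N ] f i ≤ ∑[ i < N ] g i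
  ∑-mono {zero}  _   = ≤-refl
  ∑-mono {suc N} f≤g = +-mono-≤ (f≤g Fin.zero) (∑-mono (λ i → f≤g (Fin.suc i)))

  ∑-nonNeg : ∀ {N} {f : Fin N → ℚ} → (∀ i → 0ℚ ≤ f i) → 0ℚ ≤ ∑[ i < N ] f i
  ∑-nonNeg {N} {f} 0≤f = subst (_≤ sum f) (sum-replicate-zero N) (∑-mono 0≤f)

  nbrSum : ∀ N → (ℕ → ℕ → Bool) → ℕ → (ℕ → ℚ) → ℚ
  nbrSum N adj x g = ∑[ y < N ] (if adj x (toℕ y) then g (toℕ y) else 0ℚ)

  ℕ→ℚ-count : ∀ N (p : Fin N → Bool) → ℕ→ℚ (count N p) ≡ ∑[ i < N ] (if p i then 1ℚ else 0ℚ)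
  ℕ→ℚ-count zero    p = refl
  ℕ→ℚ-count (suc N) p = trans (ℕ→ℚ-+ (if p Fin.zero then 1 else 0) (count N (λ i → p (Fin.suc i))))
    (cong₂ _+_ (if-float ℕ→ℚ (p Fin.zero)) (ℕ→ℚ-count N (λ i → p (Fin.suc i))))

  nbrSum-one : ∀ N adj x → nbrSum N adj x (λ _ → 1ℚ) ≡ ℕ→ℚ (deg N adj x)
  nbrSum-one N adj x = sym (ℕ→ℚ-count N (λ y → adj x (toℕ y)))

  sumTo-unfoldˡ : ∀ N (g : ℕ → ℚ) → sumTo (suc N) g ≡ g 0 + sumTo N (λ l → g (suc l))
  sumTo-unfoldˡ zero    g = trans (+-identityˡ (g 0)) (sym (+-identityʳ (g 0)))
  sumTo-unfoldˡ (suc N) g = trans (cong (_+ g (suc N)) (sumTo-unfoldˡ N g))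
                                  (+-assoc (g 0) (sumTo N (λ l → g (suc l))) (g (suc N)))

  ∑≡sumTo : ∀ N (g : ℕ → ℚ) → ∑[ i < N ] g (toℕ i) ≡ sumTo N g
  ∑≡sumTo zero    g = refl
  ∑≡sumTo (suc N) g = trans (cong (_+_ (g 0)) (∑≡sumTo N (λ l → g (suc l)))) (sym (sumTo-unfoldˡ N g))

  sumTo-cong : ∀ N {g h : ℕ → ℚ} → (∀ l → l ℕ.< N → g l ≡ h l) → sumTo N g ≡ sumTo N h
  sumTo-cong zero    _   = refl
  sumTo-cong (suc N) g≡h = cong₂ _+_ (sumTo-cong N (λ l l<N → g≡h l (ℕ.m<n⇒m<1+n l<N))) (g≡h N ℕ.≤-refl)

  sumTo-const : ∀ N c → sumTo N (λ _ → c) ≡ ℕ→ℚ N * c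
  sumTo-const zero    c = sym (*-zeroˡ c)
  sumTo-const (suc N) c = begin
    sumTo N (λ _ → c) + c        ≡⟨ cong (_+ c) (sumTo-const N c) ⟩
    ℕ→ℚ N * c + c                ≡⟨ cong (_+_ (ℕ→ℚ N * c)) (*-identityˡ c) ⟨
    ℕ→ℚ N * c + 1ℚ * c           ≡⟨ *-distribʳ-+ c (ℕ→ℚ N) 1ℚ ⟨
    (ℕ→ℚ N + 1ℚ) * c             ≡⟨ cong (_* c) (ℕ→ℚ-+ N 1) ⟨
    ℕ→ℚ (N ℕ.+ 1) * c            ≡⟨ cong (λ m → ℕ→ℚ m * c) (ℕ.+-comm N 1) ⟩
    ℕ→ℚ (suc N) * c              ∎
    where open ≡-Reasoning

  sumTo-zero : ∀ N {g : ℕ → ℚ} → (∀ l → l ℕ.< N → g l ≡ 0ℚ) → sumTo N g ≡ 0ℚ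
  sumTo-zero N g≡0 = trans (sumTo-cong N g≡0) (trans (sumTo-const N 0ℚ) (*-zeroʳ (ℕ→ℚ N)))

  sumTo-+ : ∀ N (g h : ℕ → ℚ) → sumTo N (λ l → g l + h l) ≡ sumTo N g + sumTo N h
  sumTo-+ N g h = begin
    sumTo N (λ l → g l + h l)                  ≡⟨ ∑≡sumTo N (λ l → g l + h l) ⟨
    ∑[ i < N ] (g (toℕ i) + h (toℕ i))         ≡⟨ ∑-distrib-+ {N} (λ i → g (toℕ i)) (λ i → h (toℕ i)) ⟩
    ∑[ i < N ] g (toℕ i) + ∑[ i < N ] h (toℕ i) ≡⟨ cong₂ _+_ (∑≡sumTo N g) (∑≡sumTo N h) ⟩
    sumTo N g + sumTo N h                      ∎
    where open ≡-Reasoning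

  sumTo-++ : ∀ m n (g : ℕ → ℚ) → sumTo (m ℕ.+ n) g ≡ sumTo m g + sumTo n (λ l → g (m ℕ.+ l))
  sumTo-++ m zero    g rewrite ℕ.+-identityʳ m = sym (+-identityʳ (sumTo m g))
  sumTo-++ m (suc n) g rewrite ℕ.+-suc m n =
    trans (cong (_+ g (m ℕ.+ n)) (sumTo-++ m n g)) (+-assoc (sumTo m g) _ (g (m ℕ.+ n)))

  sumTo-indicator : ∀ N a (g : ℕ → ℚ) → a ℕ.< N → sumTo N (λ l → if l ≡ᵇ a then g l else 0ℚ) ≡ g a
  sumTo-indicator (suc N) a g a<1+N with ℕ.m≤n⇒m<n∨m≡n (ℕ.≤-pred a<1+N)
  ... | inj₁ a<N rewrite ≡ᵇ-false (ℕ.>⇒≢ a<N) = trans (+-identityʳ _) (sumTo-indicator N a g a<N)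
  ... | inj₂ refl rewrite ≡ᵇ-refl a = trans (cong (_+ g a) (sumTo-zero a off)) (+-identityˡ (g a))
    where
    off : ∀ l → l ℕ.< a → (if l ≡ᵇ a then g l else 0ℚ) ≡ 0ℚ
    off l l<a rewrite ≡ᵇ-false (ℕ.<⇒≢ l<a) = refl

module FirstMoment
  (S H Φ : ℕ → ℚ) (F : ℕ)
  (S-split : ∀ t → S t ≡ S (suc t) ℚ.+ H (suc t))
  (Φ-drop : ∀ t → Φ (suc t) ℚ.+ S t ≡ Φ t)
  (S≥0 : ∀ t → 0ℚ ℚ.≤ S t) (H≥0 : ∀ t → 0ℚ ℚ.≤ H t) (Φ≥0 : ∀ t → 0ℚ ℚ.≤ Φ t)
  (Φ≤F*S : ∀ t → Φ t ℚ.≤ ℕ→ℚ F ℚ.* S t) (Φ₀≤F : Φ 0 ℚ.≤ ℕ→ℚ F)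
  where

  open Rationals
  open import Data.Nat as ℕ using (ℕ; zero; suc; z≤n; s≤s)
  import Data.Nat.Properties as ℕ
  open import Data.Product using (_,_)
  open import Data.Sum using (inj₁; inj₂)
  open import Data.Rational using (ℚ; 0ℚ; 1ℚ; _+_; _-_; _*_; _≤_; _<_; ∣_∣; nonNegative)
  open import Data.Rational.Properties
  open import Relation.Binary.PropositionalEquality
  open import Tactic.RingSolver using (solve-∀)

  E : ℕ → ℚ
  E m = sumTo m (λ t → ℕ→ℚ t * H t)

  W : ℕ → ℕ → ℚ
  W c t = ℕ→ℚ c * S t + Φ t

  W≥0 : ∀ c t → 0ℚ ≤ W c t
  W≥0 c t = 0≤p+q (0≤p*q (0≤ℕ→ℚ c) (S≥0 t)) (Φ≥0 t)

  S-antitone : ∀ t → S (suc t) ≤ S t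
  S-antitone t = subst (S (suc t) ≤_) (sym (S-split t)) (p≤p+q (S (suc t)) (H≥0 (suc t)))

  W-unfold : ∀ c t → ℕ→ℚ (suc c) * S t + Φ (suc t) ≡ W c t
  W-unfold c t = begin
    ℕ→ℚ (suc c) * S t + Φ (suc t)     ≡⟨ cong (λ x → x * S t + Φ (suc t)) (ℕ→ℚ-+ 1 c) ⟩
    (1ℚ + ℕ→ℚ c) * S t + Φ (suc t)    ≡⟨ regroup (ℕ→ℚ c) (S t) (Φ (suc t)) ⟩
    ℕ→ℚ c * S t + (Φ (suc t) + S t)   ≡⟨ cong (_+_ (ℕ→ℚ c * S t)) (Φ-drop t) ⟩
    W c t                             ∎
    where
    open ≡-Reasoning
    regroup : ∀ c s φ → (1ℚ + c) * s + φ ≡ c * s + (φ + s)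
    regroup = solve-∀ ℚ-ring

  W-step : ∀ c t → W (suc c) (suc t) ≤ W c t
  W-step c t = subst (W (suc c) (suc t) ≤_) (W-unfold c t)
    (+-monoˡ-≤ (Φ (suc t)) (*-monoˡ-≤-ℕ→ℚ (suc c) (S-antitone t)))

  E+W≡Φ₀ : ∀ t → E (suc t) + W t t ≡ Φ 0
  E+W≡Φ₀ zero rewrite *-zeroˡ (H 0) | *-zeroˡ (S 0) | +-identityˡ (Φ 0) = +-identityˡ (Φ 0)
  E+W≡Φ₀ (suc t) = begin
    E (suc t) + c * H (suc t) + (c * S (suc t) + Φ (suc t))
      ≡⟨ regroup (E (suc t)) c (H (suc t)) (S (suc t)) (Φ (suc t)) ⟩
    E (suc t) + (c * (S (suc t) + H (suc t)) + Φ (suc t))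
      ≡⟨ cong (λ s → E (suc t) + (c * s + Φ (suc t))) (S-split t) ⟨
    E (suc t) + (c * S t + Φ (suc t))
      ≡⟨ cong (_+_ (E (suc t))) (W-unfold t t) ⟩
    E (suc t) + W t t
      ≡⟨ E+W≡Φ₀ t ⟩
    Φ 0 ∎
    where
    open ≡-Reasoning
    c : ℚ
    c = ℕ→ℚ (suc t)
    regroup : ∀ e c h s φ → e + c * h + (c * s + φ) ≡ e + (c * (s + h) + φ)
    regroup = solve-∀ ℚ-ring

  W-window : ∀ c a → W c (c ℕ.+ a) ≤ Φ a
  W-window zero    a = ≤-reflexive (trans (cong (_+ Φ a) (*-zeroˡ (S a))) (+-identityˡ (Φ a)))
  W-window (suc c) a = ≤-trans (W-step c (c ℕ.+ a)) (W-window c a)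

  W-antitone : ∀ {s t} → s ℕ.≤ t → W t t ≤ W s s
  W-antitone {s} {zero}  z≤n = ≤-refl
  W-antitone {s} {suc t} s≤1+t with ℕ.m≤n⇒m<n∨m≡n s≤1+t
  ... | inj₁ s<1+t = ≤-trans (W-step t t) (W-antitone (ℕ.≤-pred s<1+t))
  ... | inj₂ refl  = ≤-refl

  c*S≤W : ∀ c t → ℕ→ℚ c * S t ≤ W c t
  c*S≤W c t = p≤p+q (ℕ→ℚ c * S t) (Φ≥0 t)

  a*S≤F : ∀ a → ℕ→ℚ a * S a ≤ ℕ→ℚ F
  a*S≤F a = begin
    ℕ→ℚ a * S a         ≡⟨ cong (λ t → ℕ→ℚ a * S t) (ℕ.+-identityʳ a) ⟨
    ℕ→ℚ a * S (a ℕ.+ 0) ≤⟨ c*S≤W a (a ℕ.+ 0) ⟩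
    W a (a ℕ.+ 0)       ≤⟨ W-window a 0 ⟩
    Φ 0                 ≤⟨ Φ₀≤F ⟩
    ℕ→ℚ F               ∎
    where open ≤-Reasoning

  a*Φ≤F² : ∀ a → ℕ→ℚ a * Φ a ≤ ℕ→ℚ (F ℕ.* F)
  a*Φ≤F² a = begin
    ℕ→ℚ a * Φ a               ≤⟨ *-monoˡ-≤-ℕ→ℚ a (Φ≤F*S a) ⟩
    ℕ→ℚ a * (ℕ→ℚ F * S a)     ≡⟨ swap (ℕ→ℚ a) (ℕ→ℚ F) (S a) ⟩
    ℕ→ℚ F * (ℕ→ℚ a * S a)     ≤⟨ *-monoˡ-≤-ℕ→ℚ F (a*S≤F a) ⟩
    ℕ→ℚ F * ℕ→ℚ F             ≡⟨ ℕ→ℚ-* F F ⟨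
    ℕ→ℚ (F ℕ.* F)             ∎
    where
    open ≤-Reasoning
    swap : ∀ x y z → x * (y * z) ≡ y * (x * z)
    swap = solve-∀ ℚ-ring

  W[2a]≤2Φ : ∀ a → W (a ℕ.+ a) (a ℕ.+ a) ≤ Φ a + Φ a
  W[2a]≤2Φ a = begin
    W (a ℕ.+ a) (a ℕ.+ a)                      ≡⟨ cong (λ x → x * S (a ℕ.+ a) + Φ (a ℕ.+ a)) (ℕ→ℚ-+ a a) ⟩
    (ℕ→ℚ a + ℕ→ℚ a) * S (a ℕ.+ a) + Φ (a ℕ.+ a) ≡⟨ split (ℕ→ℚ a) (S (a ℕ.+ a)) (Φ (a ℕ.+ a)) ⟩
    ℕ→ℚ a * S (a ℕ.+ a) + W a (a ℕ.+ a)        ≤⟨ +-mono-≤ (≤-trans (c*S≤W a (a ℕ.+ a)) (W-window a a)) (W-window a a) ⟩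
    Φ a + Φ a                                  ∎
    where
    open ≤-Reasoning
    split : ∀ a s φ → (a + a) * s + φ ≡ a * s + (a * s + φ)
    split = solve-∀ ℚ-ring

  a*W[2a]≤2F² : ∀ a → ℕ→ℚ a * W (a ℕ.+ a) (a ℕ.+ a) ≤ ℕ→ℚ (F ℕ.* F ℕ.+ F ℕ.* F)
  a*W[2a]≤2F² a = begin
    ℕ→ℚ a * W (a ℕ.+ a) (a ℕ.+ a)     ≤⟨ *-monoˡ-≤-ℕ→ℚ a (W[2a]≤2Φ a) ⟩
    ℕ→ℚ a * (Φ a + Φ a)               ≡⟨ *-distribˡ-+ (ℕ→ℚ a) (Φ a) (Φ a) ⟩
    ℕ→ℚ a * Φ a + ℕ→ℚ a * Φ a         ≤⟨ +-mono-≤ (a*Φ≤F² a) (a*Φ≤F² a) ⟩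
    ℕ→ℚ (F ℕ.* F) + ℕ→ℚ (F ℕ.* F)     ≡⟨ ℕ→ℚ-+ (F ℕ.* F) (F ℕ.* F) ⟨
    ℕ→ℚ (F ℕ.* F ℕ.+ F ℕ.* F)         ∎
    where open ≤-Reasoning

  E⟶Φ₀ : ConvergesTo E (Φ 0)
  E⟶Φ₀ ε ε>0 with archimedean (F ℕ.* F ℕ.+ F ℕ.* F) ε ε>0
  ... | a , 2F²<a*ε = suc (a ℕ.+ a) , close
    where
    W[2a]<ε : W (a ℕ.+ a) (a ℕ.+ a) < ε
    W[2a]<ε = *-cancelˡ-<-nonNeg (ℕ→ℚ a) {{nonNegative (0≤ℕ→ℚ a)}} (≤-<-trans (a*W[2a]≤2F² a) 2F²<a*ε)
    close : ∀ m → suc (a ℕ.+ a) ℕ.≤ m → ∣ E m - Φ 0 ∣ < ε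
    close (suc t) (s≤s 2a≤t) = ∣p-[p+r]∣<ε {E (suc t)} (E+W≡Φ₀ t) (W≥0 t t) (≤-<-trans (W-antitone 2a≤t) W[2a]<ε)

module PotentialMethod
  (N : ℕ) (adj : ℕ → ℕ → Bool) (u : ℕ) (f : ℕ → ℚ) (F : ℕ)
  (deg≢0 : ∀ (x : Fin N) → toℕ x ≢ u → deg N adj (toℕ x) ≢ 0)
  (harmonic : ∀ (x : Fin N) → toℕ x ≢ u →
     Sums.nbrSum N adj (toℕ x) f ≡ ℕ→ℚ (deg N adj (toℕ x)) ℚ.* (f (toℕ x) ℚ.- 1ℚ))
  (f[u]≡0 : f u ≡ 0ℚ)
  (f≥0 : ∀ (x : Fin N) → 0ℚ ℚ.≤ f (toℕ x))
  (f≤F : ∀ (x : Fin N) → f (toℕ x) ℚ.≤ ℕ→ℚ F)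
  (v : ℕ) (v<N : v ℕ.< N)
  where

  open BooleanTests
  open Rationals
  open Sums
  open FirstMoment using (E⟶Φ₀)
  open import Data.Bool using (true; false; if_then_else_)
  open import Data.Fin using (fromℕ<)
  open import Data.Fin.Properties using (toℕ-fromℕ<)
  open import Data.Nat using (zero; _≡ᵇ_)
  open import Data.Rational using (_+_; _-_; _*_; _≤_; nonNegative)
  open import Data.Rational.Properties
  open import Relation.Binary.PropositionalEquality
  open import Tactic.RingSolver using (solve-∀)

  P : ℕ → Fin N → ℚ
  P = walkDist N adj v u

  alive : ℕ → Fin N → ℚ
  alive t y = if toℕ y ≡ᵇ u then 0ℚ else P t y

  absorbed : ℕ → Fin N → ℚ
  absorbed t y = if toℕ y ≡ᵇ u then P t y else 0ℚ

  S H Φ : ℕ → ℚ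
  S t = ∑[ y < N ] alive t y
  H t = hitProb N adj v u t
  Φ t = ∑[ y < N ] (P t y * f (toℕ y))

  w : Fin N → ℚ
  w x = invDeg (deg N adj (toℕ x))

  nbrs : Fin N → (ℕ → ℚ) → ℚ
  nbrs x = nbrSum N adj (toℕ x)

  w*nbrs[1]≡1 : ∀ x → toℕ x ≢ u → w x * nbrs x (λ _ → 1ℚ) ≡ 1ℚ
  w*nbrs[1]≡1 x x≢u = trans (cong (_*_ (w x)) (nbrSum-one N adj (toℕ x)))
                            (invDeg-inverse (deg N adj (toℕ x)) (deg≢0 x x≢u))

  w*nbrs[f]≡f-1 : ∀ x → toℕ x ≢ u → w x * nbrs x f ≡ f (toℕ x) - 1ℚ
  w*nbrs[f]≡f-1 x x≢u = begin
    w x * nbrs x f                  ≡⟨ cong (_*_ (w x)) (harmonic x x≢u) ⟩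
    w x * (d * (f (toℕ x) - 1ℚ))    ≡⟨ *-assoc (w x) d (f (toℕ x) - 1ℚ) ⟨
    w x * d * (f (toℕ x) - 1ℚ)      ≡⟨ cong (_* (f (toℕ x) - 1ℚ)) (invDeg-inverse (deg N adj (toℕ x)) (deg≢0 x x≢u)) ⟩
    1ℚ * (f (toℕ x) - 1ℚ)           ≡⟨ *-identityˡ (f (toℕ x) - 1ℚ) ⟩
    f (toℕ x) - 1ℚ                  ∎
    where
    open ≡-Reasoning
    d : ℚ
    d = ℕ→ℚ (deg N adj (toℕ x))

  P-step : ∀ t g → ∑[ y < N ] (P (suc t) y * g (toℕ y)) ≡ ∑[ x < N ] (alive t x * (w x * nbrs x g))
  P-step t g = begin
    ∑[ y < N ] (P (suc t) y * g (toℕ y))         ≡⟨ sum-cong-≗ {N} (λ y → cong (_* g (toℕ y)) (sumFin≡∑ N (λ x → K x y))) ⟩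
    ∑[ y < N ] ((∑[ x < N ] K x y) * g (toℕ y))  ≡⟨ sum-cong-≗ {N} (λ y → *-distribʳ-sum {N} (g (toℕ y)) (λ x → K x y)) ⟩
    ∑[ y < N ] ∑[ x < N ] (K x y * g (toℕ y))    ≡⟨ ∑-comm {N} {N} (λ x y → K x y * g (toℕ y)) ⟨
    ∑[ x < N ] ∑[ y < N ] (K x y * g (toℕ y))    ≡⟨ sum-cong-≗ {N} row-sum ⟩
    ∑[ x < N ] (alive t x * (w x * nbrs x g))    ∎
    where
    open ≡-Reasoning
    K : Fin N → Fin N → ℚ
    K x y = if toℕ x ≡ᵇ u then 0ℚ else (if adj (toℕ x) (toℕ y) then P t x * w x else 0ℚ)
    pull : ∀ b p q → (if b then p else 0ℚ) * q ≡ p * (if b then q else 0ℚ)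
    pull true  p q = refl
    pull false p q = trans (*-zeroˡ q) (sym (*-zeroʳ p))
    row-sum : ∀ x → ∑[ y < N ] (K x y * g (toℕ y)) ≡ alive t x * (w x * nbrs x g)
    row-sum x = by-target (toℕ x ≡ᵇ u)
      where
      by-target : ∀ b → ∑[ y < N ] ((if b then 0ℚ else (if adj (toℕ x) (toℕ y) then P t x * w x else 0ℚ)) * g (toℕ y))
                        ≡ (if b then 0ℚ else P t x) * (w x * nbrs x g)
      by-target true  = trans (sum-cong-≗ {N} (λ y → *-zeroˡ (g (toℕ y))))
                              (trans (sum-replicate-zero N) (sym (*-zeroˡ (w x * nbrs x g))))
      by-target false = begin
        ∑[ y < N ] ((if adj (toℕ x) (toℕ y) then P t x * w x else 0ℚ) * g (toℕ y))
          ≡⟨ sum-cong-≗ {N} (λ y → pull (adj (toℕ x) (toℕ y)) (P t x * w x) (g (toℕ y))) ⟩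
        ∑[ y < N ] (P t x * w x * (if adj (toℕ x) (toℕ y) then g (toℕ y) else 0ℚ))
          ≡⟨ *-distribˡ-sum {N} (P t x * w x) (λ y → if adj (toℕ x) (toℕ y) then g (toℕ y) else 0ℚ) ⟨
        P t x * w x * nbrs x g
          ≡⟨ *-assoc (P t x) (w x) (nbrs x g) ⟩
        P t x * (w x * nbrs x g) ∎

  S-split : ∀ t → S t ≡ S (suc t) + H (suc t)
  S-split t = begin
    ∑[ x < N ] alive t x                                ≡⟨ sum-cong-≗ {N} alive≡ ⟨
    ∑[ x < N ] (alive t x * (w x * nbrs x (λ _ → 1ℚ)))  ≡⟨ P-step t (λ _ → 1ℚ) ⟨
    ∑[ y < N ] (P (suc t) y * 1ℚ)                       ≡⟨ sum-cong-≗ {N} (λ y → split (toℕ y ≡ᵇ u) (P (suc t) y)) ⟩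
    ∑[ y < N ] (alive (suc t) y + absorbed (suc t) y)   ≡⟨ ∑-distrib-+ {N} (alive (suc t)) (absorbed (suc t)) ⟩
    S (suc t) + ∑[ y < N ] absorbed (suc t) y           ≡⟨ cong (_+_ (S (suc t))) (sumFin≡∑ N (absorbed (suc t))) ⟨
    S (suc t) + H (suc t)                               ∎
    where
    open ≡-Reasoning
    alive≡ : ∀ x → alive t x * (w x * nbrs x (λ _ → 1ℚ)) ≡ alive t x
    alive≡ x with toℕ x ≡ᵇ u in e
    ... | true  = *-zeroˡ (w x * nbrs x (λ _ → 1ℚ))
    ... | false = trans (cong (_*_ (P t x)) (w*nbrs[1]≡1 x (≡ᵇ-false⇒≢ e))) (*-identityʳ (P t x))
    split : ∀ b p → p * 1ℚ ≡ (if b then 0ℚ else p) + (if b then p else 0ℚ)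
    split true  p = trans (*-identityʳ p) (sym (+-identityˡ p))
    split false p = trans (*-identityʳ p) (sym (+-identityʳ p))

  Φ-drop : ∀ t → Φ (suc t) + S t ≡ Φ t
  Φ-drop t = begin
    Φ (suc t) + S t                                                   ≡⟨ cong (_+ S t) (P-step t f) ⟩
    ∑[ x < N ] (alive t x * (w x * nbrs x f)) + ∑[ x < N ] alive t x  ≡⟨ ∑-distrib-+ {N} (λ x → alive t x * (w x * nbrs x f)) (alive t) ⟨
    ∑[ x < N ] (alive t x * (w x * nbrs x f) + alive t x)             ≡⟨ sum-cong-≗ {N} pointwise ⟩
    Φ t                                                               ∎
    where
    open ≡-Reasoning
    p[f-1]+p≡pf : ∀ p f → p * (f - 1ℚ) + p ≡ p * f
    p[f-1]+p≡pf = solve-∀ ℚ-ring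
    pointwise : ∀ x → alive t x * (w x * nbrs x f) + alive t x ≡ P t x * f (toℕ x)
    pointwise x with toℕ x ≡ᵇ u in e
    ... | true  = begin
      0ℚ * (w x * nbrs x f) + 0ℚ  ≡⟨ trans (+-identityʳ (0ℚ * (w x * nbrs x f))) (*-zeroˡ (w x * nbrs x f)) ⟩
      0ℚ                          ≡⟨ *-zeroʳ (P t x) ⟨
      P t x * 0ℚ                  ≡⟨ cong (_*_ (P t x)) (trans (cong f (≡ᵇ-true⇒≡ e)) f[u]≡0) ⟨
      P t x * f (toℕ x)           ∎
    ... | false = begin
      P t x * (w x * nbrs x f) + P t x  ≡⟨ cong (λ m → P t x * m + P t x) (w*nbrs[f]≡f-1 x (≡ᵇ-false⇒≢ e)) ⟩
      P t x * (f (toℕ x) - 1ℚ) + P t x  ≡⟨ p[f-1]+p≡pf (P t x) (f (toℕ x)) ⟩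
      P t x * f (toℕ x)                 ∎

  P≥0 : ∀ t y → 0ℚ ≤ P t y
  P≥0 zero    y = 0≤if (toℕ y ≡ᵇ v) (0≤ℕ→ℚ 1) ≤-refl
  P≥0 (suc t) y = subst (0ℚ ≤_) (sym (sumFin≡∑ N _)) (∑-nonNeg λ x →
    0≤if (toℕ x ≡ᵇ u) ≤-refl (0≤if (adj (toℕ x) (toℕ y)) (0≤p*q (P≥0 t x) (0≤invDeg (deg N adj (toℕ x)))) ≤-refl))

  S≥0 : ∀ t → 0ℚ ≤ S t
  S≥0 t = ∑-nonNeg λ y → 0≤if (toℕ y ≡ᵇ u) ≤-refl (P≥0 t y)

  H≥0 : ∀ t → 0ℚ ≤ H t
  H≥0 t = subst (0ℚ ≤_) (sym (sumFin≡∑ N (absorbed t))) (∑-nonNeg λ y → 0≤if (toℕ y ≡ᵇ u) (P≥0 t y) ≤-refl)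

  Φ≥0 : ∀ t → 0ℚ ≤ Φ t
  Φ≥0 t = ∑-nonNeg λ y → 0≤p*q (P≥0 t y) (f≥0 y)

  Φ≤F*S : ∀ t → Φ t ≤ ℕ→ℚ F * S t
  Φ≤F*S t = ≤-trans (∑-mono pointwise) (≤-reflexive (sym (*-distribˡ-sum {N} (ℕ→ℚ F) (alive t))))
    where
    pointwise : ∀ y → P t y * f (toℕ y) ≤ ℕ→ℚ F * alive t y
    pointwise y with toℕ y ≡ᵇ u in e
    ... | true  = ≤-reflexive (begin
      P t y * f (toℕ y) ≡⟨ cong (_*_ (P t y)) (trans (cong f (≡ᵇ-true⇒≡ e)) f[u]≡0) ⟩
      P t y * 0ℚ        ≡⟨ *-zeroʳ (P t y) ⟩
      0ℚ                ≡⟨ *-zeroʳ (ℕ→ℚ F) ⟨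
      ℕ→ℚ F * 0ℚ        ∎)
      where open ≡-Reasoning
    ... | false = ≤-trans (*-monoˡ-≤-nonNeg (P t y) {{nonNegative (P≥0 t y)}} (f≤F y)) (≤-reflexive (*-comm (P t y) (ℕ→ℚ F)))

  Φ₀≡f[v] : Φ 0 ≡ f v
  Φ₀≡f[v] = begin
    ∑[ y < N ] ((if toℕ y ≡ᵇ v then 1ℚ else 0ℚ) * f (toℕ y)) ≡⟨ sum-cong-≗ {N} (λ y → select (toℕ y ≡ᵇ v) (f (toℕ y))) ⟩
    ∑[ y < N ] (if toℕ y ≡ᵇ v then f (toℕ y) else 0ℚ)        ≡⟨ ∑≡sumTo N (λ l → if l ≡ᵇ v then f l else 0ℚ) ⟩
    sumTo N (λ l → if l ≡ᵇ v then f l else 0ℚ)               ≡⟨ sumTo-indicator N v f v<N ⟩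
    f v                                                      ∎
    where
    open ≡-Reasoning
    select : ∀ b p → (if b then 1ℚ else 0ℚ) * p ≡ (if b then p else 0ℚ)
    select true  p = *-identityˡ p
    select false p = *-zeroˡ p

  Φ₀≤F : Φ 0 ≤ ℕ→ℚ F
  Φ₀≤F = subst (_≤ ℕ→ℚ F) (trans (cong f (toℕ-fromℕ< v<N)) (sym Φ₀≡f[v])) (f≤F (fromℕ< v<N))

  hittingTime : HittingTimeIs N adj v u (f v)
  hittingTime = subst (ConvergesTo (expPartial N adj v u)) Φ₀≡f[v]
    (E⟶Φ₀ S H Φ F S-split Φ-drop S≥0 H≥0 Φ≥0 Φ≤F*S Φ₀≤F)

module TreeAdjacency (n hub b : ℕ) (hub<n : hub ℕ.< n) where

  open BooleanTests
  open import Data.Bool using (Bool; false; _∧_; _∨_)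
  open import Data.Bool.Properties using (∧-identityʳ; ∧-zeroʳ; ∨-identityʳ)
  open import Data.Nat
  open import Data.Nat.Properties
  open import Relation.Binary.PropositionalEquality
  open import Relation.Nullary using (yes; no)

  A : ℕ → ℕ → Bool
  A = Tadj n (suc hub) b

  spineEdge-to-spine : ∀ x {y} → y < n → spineEdge n x y ≡ (suc x ≡ᵇ y)
  spineEdge-to-spine x {y} y<n = trans (cong ((suc x ≡ᵇ y) ∧_) (<ᵇ-true y<n)) (∧-identityʳ (suc x ≡ᵇ y))

  spineEdge-to-leaf : ∀ x {y} → n ≤ y → spineEdge n x y ≡ false
  spineEdge-to-leaf x {y} n≤y = trans (cong ((suc x ≡ᵇ y) ∧_) (<ᵇ-false n≤y)) (∧-zeroʳ (suc x ≡ᵇ y))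

  spineEdge-from-leaf : ∀ {x} y → n ≤ x → spineEdge n x y ≡ false
  spineEdge-from-leaf {x} y n≤x with y <? n
  ... | yes y<n = cong (_∧ (y <ᵇ n)) (≡ᵇ-false (>⇒≢ (<-trans y<n (s≤s n≤x))))
  ... | no  y≮n = spineEdge-to-leaf x (≮⇒≥ y≮n)

  leafEdge-to-spine : ∀ x {y} → y < n → leafEdge n (suc hub) b x y ≡ false
  leafEdge-to-spine x {y} y<n =
    trans (cong (λ t → (x ≡ᵇ hub) ∧ (t ∧ (y <ᵇ n + b))) (≤ᵇ-false y<n)) (∧-zeroʳ (x ≡ᵇ hub))

  leafEdge-to-leaf : ∀ x {y} → n ≤ y → y < n + b → leafEdge n (suc hub) b x y ≡ (x ≡ᵇ hub)
  leafEdge-to-leaf x n≤y y<N =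
    trans (cong₂ (λ s t → (x ≡ᵇ hub) ∧ (s ∧ t)) (≤ᵇ-true n≤y) (<ᵇ-true y<N)) (∧-identityʳ (x ≡ᵇ hub))

  leafEdge-from-leaf : ∀ {x} y → n ≤ x → leafEdge n (suc hub) b x y ≡ false
  leafEdge-from-leaf {x} y n≤x = cong (_∧ ((n ≤ᵇ y) ∧ (y <ᵇ n + b))) (≡ᵇ-false (>⇒≢ (<-≤-trans hub<n n≤x)))

  Tadj≡ : ∀ {x y p q r s} → spineEdge n x y ≡ p → spineEdge n y x ≡ q →
          leafEdge n (suc hub) b x y ≡ r → leafEdge n (suc hub) b y x ≡ s → A x y ≡ p ∨ q ∨ r ∨ s
  Tadj≡ refl refl refl refl = refl

  A-spine-spine : ∀ {x y} → x < n → y < n → A x y ≡ (suc x ≡ᵇ y) ∨ (suc y ≡ᵇ x)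
  A-spine-spine {x} {y} x<n y<n =
    trans (Tadj≡ (spineEdge-to-spine x y<n) (spineEdge-to-spine y x<n) (leafEdge-to-spine x y<n) (leafEdge-to-spine y x<n))
          (cong ((suc x ≡ᵇ y) ∨_) (∨-identityʳ (suc y ≡ᵇ x)))

  A-spine-leaf : ∀ {x y} → x < n → n ≤ y → y < n + b → A x y ≡ (x ≡ᵇ hub)
  A-spine-leaf {x} {y} x<n n≤y y<N =
    trans (Tadj≡ (spineEdge-to-leaf x n≤y) (spineEdge-from-leaf x n≤y) (leafEdge-to-leaf x n≤y y<N) (leafEdge-to-spine y x<n))
          (∨-identityʳ (x ≡ᵇ hub))

  A-leaf-spine : ∀ {x y} → n ≤ x → x < n + b → A x y ≡ (y ≡ᵇ hub)
  A-leaf-spine {x} {y} n≤x x<N =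
    Tadj≡ (spineEdge-from-leaf y n≤x) (spineEdge-to-leaf y n≤x) (leafEdge-from-leaf y n≤x) (leafEdge-to-leaf y n≤x x<N)

  A-leaf-leaf : ∀ {x y} → n ≤ x → n ≤ y → A x y ≡ false
  A-leaf-leaf {x} {y} n≤x n≤y =
    Tadj≡ (spineEdge-from-leaf y n≤x) (spineEdge-from-leaf x n≤y) (leafEdge-from-leaf y n≤x) (leafEdge-from-leaf x n≤y)

module TreePotential (u hub b : ℕ) (0<hub : 0 ℕ.< hub) (hub≤u : hub ℕ.≤ u) where

  open BooleanTests
  open import Data.Bool using (if_then_else_)
  open import Data.Nat
  open import Data.Nat.Properties
  open import Data.Nat.Tactic.RingSolver using (solve-∀)
  open import Relation.Binary using (tri<; tri≈; tri>)
  open import Relation.Binary.PropositionalEquality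
  open import Relation.Nullary using (yes; no)
  open import Relation.Nullary.Decidable using (dec-true)

  -- Spine index j is the vertex v_{j+1}: u indexes the target v_n and hub the vertex v_k.
  leavesAt : ℕ → ℕ
  leavesAt j = if j ≡ᵇ hub then b else 0

  -- The time to step from spine index l to l + 1 is, as on any tree, one more than twice
  -- the number of edges on the side of l.
  edgesBehind : ℕ → ℕ
  edgesBehind l = if l <ᵇ hub then l else l + b

  crossing : ℕ → ℕ
  crossing l = suc (2 * edgesBehind l)

  crossingSum : ℕ → ℕ → ℕ
  crossingSum j zero    = 0
  crossingSum j (suc m) = crossing j + crossingSum (suc j) m

  spinePotential : ℕ → ℕ
  spinePotential j = crossingSum j (u ∸ j)

  crossingPrimitive : ℕ → ℕ
  crossingPrimitive l = l * l + 2 * b * (l ⊔ hub)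

  edgesBehind-below : ∀ {l} → l < hub → edgesBehind l ≡ l
  edgesBehind-below l<hub rewrite <ᵇ-true l<hub = refl

  edgesBehind-above : ∀ {l} → hub ≤ l → edgesBehind l ≡ l + b
  edgesBehind-above hub≤l rewrite <ᵇ-false hub≤l = refl

  crossing-telescopes : ∀ l → crossing l + crossingPrimitive l ≡ crossingPrimitive (suc l)
  crossing-telescopes l with l <? hub
  ... | yes l<hub rewrite edgesBehind-below l<hub | m≤n⇒m⊔n≡n (<⇒≤ l<hub) | m≤n⇒m⊔n≡n l<hub = below l b hub
    where
    below : ∀ l b h → suc (2 * l) + (l * l + 2 * b * h) ≡ suc l * suc l + 2 * b * h
    below = solve-∀
  ... | no l≮hub rewrite edgesBehind-above (≮⇒≥ l≮hub) | m≥n⇒m⊔n≡m (≮⇒≥ l≮hub)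
                       | m≥n⇒m⊔n≡m (m≤n⇒m≤1+n (≮⇒≥ l≮hub)) = above l b
    where
    above : ∀ l b → suc (2 * (l + b)) + (l * l + 2 * b * l) ≡ suc l * suc l + 2 * b * suc l
    above = solve-∀

  crossingSum-telescopes : ∀ j m → crossingSum j m + crossingPrimitive j ≡ crossingPrimitive (j + m)
  crossingSum-telescopes j zero    = cong crossingPrimitive (sym (+-identityʳ j))
  crossingSum-telescopes j (suc m) = begin
    crossing j + crossingSum (suc j) m + crossingPrimitive j   ≡⟨ regroup (crossing j) (crossingSum (suc j) m) (crossingPrimitive j) ⟩
    crossingSum (suc j) m + (crossing j + crossingPrimitive j) ≡⟨ cong (_+_ (crossingSum (suc j) m)) (crossing-telescopes j) ⟩
    crossingSum (suc j) m + crossingPrimitive (suc j)          ≡⟨ crossingSum-telescopes (suc j) m ⟩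
    crossingPrimitive (suc j + m)                              ≡⟨ cong crossingPrimitive (+-suc j m) ⟨
    crossingPrimitive (j + suc m)                              ∎
    where
    open ≡-Reasoning
    regroup : ∀ c s q → c + s + q ≡ s + (c + q)
    regroup = solve-∀

  spinePotential-closed : ∀ {j} → j ≤ u → spinePotential j + crossingPrimitive j ≡ crossingPrimitive u
  spinePotential-closed {j} j≤u = trans (crossingSum-telescopes j (u ∸ j)) (cong crossingPrimitive (m+[n∸m]≡n j≤u))

  spinePotential≤crossingPrimitive[u] : ∀ {j} → j ≤ u → spinePotential j ≤ crossingPrimitive u
  spinePotential≤crossingPrimitive[u] {j} j≤u = subst (spinePotential j ≤_) (spinePotential-closed j≤u) (m≤m+n _ (crossingPrimitive j))

  spinePotential-step : ∀ {j} → j < u → spinePotential j ≡ crossing j + spinePotential (suc j)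
  spinePotential-step {j} j<u = cong (crossingSum j) (+-∸-assoc 1 j<u)

  spinePotential-target : spinePotential u ≡ 0
  spinePotential-target rewrite n∸n≡0 u = refl

  crossing-zero : crossing 0 ≡ 1
  crossing-zero rewrite edgesBehind-below 0<hub = refl

  crossing-suc : ∀ i → crossing (suc i) ≡ crossing i + 2 * suc (leavesAt (suc i))
  crossing-suc i with <-cmp (suc i) hub
  ... | tri< 1+i<hub 1+i≢hub _ rewrite edgesBehind-below 1+i<hub | edgesBehind-below (<⇒≤ 1+i<hub)
                                     | ≡ᵇ-false 1+i≢hub = below i
    where
    below : ∀ i → suc (2 * suc i) ≡ suc (2 * i) + 2 * 1
    below = solve-∀
  ... | tri≈ _ 1+i≡hub _ rewrite edgesBehind-above (≤-reflexive (sym 1+i≡hub))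
                               | edgesBehind-below (subst (i <_) 1+i≡hub (n<1+n i))
                               | dec-true (suc i ≟ hub) 1+i≡hub = at i b
    where
    at : ∀ i b → suc (2 * (suc i + b)) ≡ suc (2 * i) + 2 * suc b
    at = solve-∀
  ... | tri> _ 1+i≢hub hub<1+i rewrite edgesBehind-above (<⇒≤ hub<1+i) | edgesBehind-above (≤-pred hub<1+i)
                                     | ≡ᵇ-false 1+i≢hub = above i b
    where
    above : ∀ i b → suc (2 * (suc i + b)) ≡ suc (2 * (i + b)) + 2 * 1
    above = solve-∀

  leavesAt-hub : ∀ j (γ : ℕ → ℕ) → leavesAt j * γ hub ≡ leavesAt j * γ j
  leavesAt-hub j γ with j ≟ hub
  ... | yes j≡hub = cong (λ x → leavesAt j * γ x) (sym j≡hub)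
  ... | no  j≢hub rewrite ≡ᵇ-false j≢hub = refl

  leafPotential : ℕ
  leafPotential = suc (spinePotential hub)

  potential : ℕ → ℕ
  potential x = if x <ᵇ suc u then spinePotential x else leafPotential

  potential-spine : ∀ {x} → x < suc u → potential x ≡ spinePotential x
  potential-spine x<n rewrite <ᵇ-true x<n = refl

  potential-leaf : ∀ {x} → suc u ≤ x → potential x ≡ leafPotential
  potential-leaf n≤x rewrite <ᵇ-false n≤x = refl

  potential-bounded : ∀ x → potential x ≤ suc (crossingPrimitive u)
  potential-bounded x with x <? suc u
  ... | yes x<n = subst (_≤ suc (crossingPrimitive u)) (sym (potential-spine x<n)) (m≤n⇒m≤1+n (spinePotential≤crossingPrimitive[u] (≤-pred x<n)))
  ... | no  x≮n = subst (_≤ suc (crossingPrimitive u)) (sym (potential-leaf (≮⇒≥ x≮n))) (s≤s (spinePotential≤crossingPrimitive[u] hub≤u))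

  balance-start : potential 1 + 1 ≡ 1 * potential 0
  balance-start rewrite potential-spine (s≤s (<-≤-trans 0<hub hub≤u)) | potential-spine (s≤s z≤n) = begin
    spinePotential 1 + 1                 ≡⟨ start (spinePotential 1) ⟩
    1 * (1 + spinePotential 1)           ≡⟨ cong (λ c → 1 * (c + spinePotential 1)) crossing-zero ⟨
    1 * (crossing 0 + spinePotential 1)  ≡⟨ cong (1 *_) (spinePotential-step 0<u) ⟨
    1 * spinePotential 0                 ∎
    where
    open ≡-Reasoning
    0<u : 0 < u
    0<u = <-≤-trans 0<hub hub≤u
    start : ∀ x → x + 1 ≡ 1 * (1 + x)
    start = solve-∀

  balance-interior : ∀ {i} → suc i < u →
    potential (suc (suc i)) + potential i + leavesAt (suc i) * leafPotential + suc (suc (leavesAt (suc i)))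
    ≡ suc (suc (leavesAt (suc i))) * potential (suc i)
  balance-interior {i} 1+i<u
    rewrite potential-spine (s≤s 1+i<u) | potential-spine (<-trans (n<1+n i) (m<n⇒m<1+n 1+i<u))
          | potential-spine (m<n⇒m<1+n 1+i<u) = begin
    φ (suc (suc i)) + φ i + L * suc (φ hub) + suc (suc L)
      ≡⟨ cong (λ t → φ (suc (suc i)) + φ i + t + suc (suc L)) (leavesAt-hub (suc i) (λ x → suc (φ x))) ⟩
    φ (suc (suc i)) + φ i + L * suc (φ (suc i)) + suc (suc L)
      ≡⟨ second-difference (spinePotential-step (<-trans (n<1+n i) 1+i<u)) (spinePotential-step 1+i<u) (crossing-suc i) ⟩
    suc (suc L) * φ (suc i) ∎
    where
    open ≡-Reasoning
    φ : ℕ → ℕ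
    φ = spinePotential
    L : ℕ
    L = leavesAt (suc i)
    identity : ∀ x a L → x + (a + (a + 2 * suc L + x)) + L * suc (a + 2 * suc L + x) + suc (suc L)
                       ≡ suc (suc L) * (a + 2 * suc L + x)
    identity = solve-∀
    second-difference : ∀ {x y z a c L} → z ≡ a + y → y ≡ c + x → c ≡ a + 2 * suc L →
                        x + z + L * suc y + suc (suc L) ≡ suc (suc L) * y
    second-difference {x} {a = a} {L = L} refl refl refl = identity x a L

  balance-leaf : ∀ l → potential hub + 1 ≡ 1 * potential (suc u + l)
  balance-leaf l rewrite potential-spine (s≤s hub≤u) | potential-leaf (m≤m+n (suc u) l) = leaf (spinePotential hub)
    where
    leaf : ∀ x → x + 1 ≡ 1 * suc x
    leaf = solve-∀

  potential-closed : ∀ {j} → j ≤ u → potential j + crossingPrimitive j ≡ u * u + 2 * b * u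
  potential-closed {j} j≤u = begin
    potential j + crossingPrimitive j        ≡⟨ cong (_+ crossingPrimitive j) (potential-spine (s≤s j≤u)) ⟩
    spinePotential j + crossingPrimitive j   ≡⟨ spinePotential-closed j≤u ⟩
    u * u + 2 * b * (u ⊔ hub) ≡⟨ cong (λ m → u * u + 2 * b * m) (m≥n⇒m⊔n≡m hub≤u) ⟩
    u * u + 2 * b * u        ∎
    where open ≡-Reasoning

  potential-below-hub : ∀ {j} → j ≤ hub → potential j + (j * j + 2 * b * hub) ≡ u * u + 2 * b * u
  potential-below-hub {j} j≤hub =
    trans (cong (λ m → potential j + (j * j + 2 * b * m)) (sym (m≤n⇒m⊔n≡n j≤hub))) (potential-closed (≤-trans j≤hub hub≤u))

  potential-above-hub : ∀ {j} → hub ≤ j → j ≤ u → potential j + (j * j + 2 * b * j) ≡ u * u + 2 * b * u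
  potential-above-hub {j} hub≤j j≤u =
    trans (cong (λ m → potential j + (j * j + 2 * b * m)) (sym (m≥n⇒m⊔n≡m hub≤j))) (potential-closed j≤u)

module TreeHittingTimes (u hub b : ℕ) (0<hub : 0 ℕ.< hub) (hub<u : hub ℕ.< u) where

  open BooleanTests
  open Rationals
  open Sums
  open import Data.Bool using (true; false; if_then_else_; _∨_)
  open import Data.Fin using (toℕ)
  open import Data.Fin.Properties using (toℕ<n)
  import Data.Integer as ℤ
  open import Data.Nat as ℕ using (ℕ; zero; suc; _≡ᵇ_; _∸_; s≤s)
  import Data.Nat.Properties as ℕ
  open import Data.Rational using (ℚ; 0ℚ; 1ℚ; _+_; _-_; _*_)
  open import Data.Rational.Properties
  open import Function using (_∘_)
  open import Relation.Binary.PropositionalEquality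
  open import Relation.Nullary using (yes; no)

  n N : ℕ
  n = suc u
  N = n ℕ.+ b

  open TreePotential u hub b 0<hub (ℕ.<⇒≤ hub<u) public
  open TreeAdjacency n hub b (ℕ.m<n⇒m<1+n hub<u)

  nbrSum-split : ∀ x g → nbrSum N A x g ≡ sumTo n (λ y → if A x y then g y else 0ℚ)
                                      + sumTo b (λ l → if A x (n ℕ.+ l) then g (n ℕ.+ l) else 0ℚ)
  nbrSum-split x g = trans (∑≡sumTo N (λ y → if A x y then g y else 0ℚ)) (sumTo-++ n b (λ y → if A x y then g y else 0ℚ))

  spine-nbrs : ∀ {j} g → j ℕ.< u →
    sumTo n (λ y → if A j y then g y else 0ℚ) ≡ g (suc j) + sumTo n (λ y → if suc y ≡ᵇ j then g y else 0ℚ)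
  spine-nbrs {j} g j<u = begin
    sumTo n (λ y → if A j y then g y else 0ℚ)
      ≡⟨ sumTo-cong n (λ y y<n → trans (cong (λ e → if e then g y else 0ℚ) (A-spine-spine j<n y<n)) (split y)) ⟩
    sumTo n (λ y → (if y ≡ᵇ suc j then g y else 0ℚ) + (if suc y ≡ᵇ j then g y else 0ℚ))
      ≡⟨ sumTo-+ n (λ y → if y ≡ᵇ suc j then g y else 0ℚ) (λ y → if suc y ≡ᵇ j then g y else 0ℚ) ⟩
    sumTo n (λ y → if y ≡ᵇ suc j then g y else 0ℚ) + sumTo n (λ y → if suc y ≡ᵇ j then g y else 0ℚ)
      ≡⟨ cong (_+ sumTo n (λ y → if suc y ≡ᵇ j then g y else 0ℚ)) (sumTo-indicator n (suc j) g (s≤s j<u)) ⟩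
    g (suc j) + sumTo n (λ y → if suc y ≡ᵇ j then g y else 0ℚ) ∎
    where
    open ≡-Reasoning
    j<n : j ℕ.< n
    j<n = ℕ.m<n⇒m<1+n j<u
    split : ∀ y → (if (suc j ≡ᵇ y) ∨ (suc y ≡ᵇ j) then g y else 0ℚ)
                  ≡ (if y ≡ᵇ suc j then g y else 0ℚ) + (if suc y ≡ᵇ j then g y else 0ℚ)
    split y with y ℕ.≟ suc j
    ... | yes refl rewrite ≡ᵇ-refl j | ≡ᵇ-false (ℕ.>⇒≢ (ℕ.m<n⇒m<1+n (ℕ.n<1+n j))) = sym (+-identityʳ (g (suc j)))
    ... | no  y≢1+j rewrite ≡ᵇ-false y≢1+j | ≡ᵇ-false (y≢1+j ∘ sym) = sym (+-identityˡ _)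

  leaf-nbrs : ∀ {j} (γ : ℕ → ℕ) {c} → j ℕ.< n → (∀ l → l ℕ.< b → γ (n ℕ.+ l) ≡ c) →
    sumTo b (λ l → if A j (n ℕ.+ l) then ℕ→ℚ (γ (n ℕ.+ l)) else 0ℚ) ≡ ℕ→ℚ (leavesAt j ℕ.* c)
  leaf-nbrs {j} γ {c} j<n γ≡c = begin
    sumTo b (λ l → if A j (n ℕ.+ l) then ℕ→ℚ (γ (n ℕ.+ l)) else 0ℚ)
      ≡⟨ sumTo-cong b (λ l l<b → cong₂ (λ e x → if e then ℕ→ℚ x else 0ℚ)
                                      (A-spine-leaf j<n (ℕ.m≤m+n n l) (ℕ.+-monoʳ-< n l<b)) (γ≡c l l<b)) ⟩
    sumTo b (λ _ → if j ≡ᵇ hub then ℕ→ℚ c else 0ℚ)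
      ≡⟨ sumTo-const b (if j ≡ᵇ hub then ℕ→ℚ c else 0ℚ) ⟩
    ℕ→ℚ b * (if j ≡ᵇ hub then ℕ→ℚ c else 0ℚ)
      ≡⟨ at-hub (j ≡ᵇ hub) ⟩
    ℕ→ℚ (leavesAt j ℕ.* c) ∎
    where
    open ≡-Reasoning
    at-hub : ∀ e → ℕ→ℚ b * (if e then ℕ→ℚ c else 0ℚ) ≡ ℕ→ℚ ((if e then b else 0) ℕ.* c)
    at-hub true  = sym (ℕ→ℚ-* b c)
    at-hub false = *-zeroʳ (ℕ→ℚ b)

  nbrSum-start : ∀ (γ : ℕ → ℕ) → nbrSum N A 0 (ℕ→ℚ ∘ γ) ≡ ℕ→ℚ (γ 1)
  nbrSum-start γ = begin
    nbrSum N A 0 g                                                ≡⟨ nbrSum-split 0 g ⟩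
    sumTo n (λ y → if A 0 y then g y else 0ℚ) + leafPart      ≡⟨ cong₂ _+_ (spine-nbrs g 0<u) (sumTo-zero b no-leaf) ⟩
    g 1 + sumTo n (λ _ → 0ℚ) + 0ℚ                             ≡⟨ cong (λ s → g 1 + s + 0ℚ) (sumTo-zero n (λ _ _ → refl)) ⟩
    g 1 + 0ℚ + 0ℚ                                             ≡⟨ trans (+-identityʳ (g 1 + 0ℚ)) (+-identityʳ (g 1)) ⟩
    g 1                                                       ∎
    where
    open ≡-Reasoning
    g : ℕ → ℚ
    g = ℕ→ℚ ∘ γ
    0<u : 0 ℕ.< u
    0<u = ℕ.<-trans 0<hub hub<u
    leafPart : ℚ
    leafPart = sumTo b (λ l → if A 0 (n ℕ.+ l) then g (n ℕ.+ l) else 0ℚ)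
    no-leaf : ∀ l → l ℕ.< b → (if A 0 (n ℕ.+ l) then g (n ℕ.+ l) else 0ℚ) ≡ 0ℚ
    no-leaf l l<b rewrite A-spine-leaf (ℕ.s≤s ℕ.z≤n) (ℕ.m≤m+n n l) (ℕ.+-monoʳ-< n l<b) | ≡ᵇ-false (ℕ.<⇒≢ 0<hub) = refl

  nbrSum-interior : ∀ {i} (γ : ℕ → ℕ) {c} → suc i ℕ.< u → (∀ l → l ℕ.< b → γ (n ℕ.+ l) ≡ c) →
    nbrSum N A (suc i) (ℕ→ℚ ∘ γ) ≡ ℕ→ℚ (γ (suc (suc i)) ℕ.+ γ i ℕ.+ leavesAt (suc i) ℕ.* c)
  nbrSum-interior {i} γ {c} 1+i<u γ≡c = begin
    nbrSum N A (suc i) g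
      ≡⟨ nbrSum-split (suc i) g ⟩
    sumTo n (λ y → if A (suc i) y then g y else 0ℚ) + sumTo b (λ l → if A (suc i) (n ℕ.+ l) then g (n ℕ.+ l) else 0ℚ)
      ≡⟨ cong₂ _+_ (spine-nbrs g 1+i<u) (leaf-nbrs γ (ℕ.m<n⇒m<1+n 1+i<u) γ≡c) ⟩
    g (suc (suc i)) + sumTo n (λ y → if y ≡ᵇ i then g y else 0ℚ) + ℕ→ℚ (leavesAt (suc i) ℕ.* c)
      ≡⟨ cong (λ s → g (suc (suc i)) + s + ℕ→ℚ (leavesAt (suc i) ℕ.* c)) (sumTo-indicator n i g i<n) ⟩
    g (suc (suc i)) + g i + ℕ→ℚ (leavesAt (suc i) ℕ.* c)
      ≡⟨ cong (_+ ℕ→ℚ (leavesAt (suc i) ℕ.* c)) (ℕ→ℚ-+ (γ (suc (suc i))) (γ i)) ⟨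
    ℕ→ℚ (γ (suc (suc i)) ℕ.+ γ i) + ℕ→ℚ (leavesAt (suc i) ℕ.* c)
      ≡⟨ ℕ→ℚ-+ (γ (suc (suc i)) ℕ.+ γ i) (leavesAt (suc i) ℕ.* c) ⟨
    ℕ→ℚ (γ (suc (suc i)) ℕ.+ γ i ℕ.+ leavesAt (suc i) ℕ.* c) ∎
    where
    open ≡-Reasoning
    g : ℕ → ℚ
    g = ℕ→ℚ ∘ γ
    i<n : i ℕ.< n
    i<n = ℕ.<-trans (ℕ.n<1+n i) (ℕ.m<n⇒m<1+n 1+i<u)

  nbrSum-leaf : ∀ {l} (γ : ℕ → ℕ) → l ℕ.< b → nbrSum N A (n ℕ.+ l) (ℕ→ℚ ∘ γ) ≡ ℕ→ℚ (γ hub)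
  nbrSum-leaf {l} γ l<b = begin
    nbrSum N A (n ℕ.+ l) g
      ≡⟨ nbrSum-split (n ℕ.+ l) g ⟩
    sumTo n (λ y → if A (n ℕ.+ l) y then g y else 0ℚ) + sumTo b (λ m → if A (n ℕ.+ l) (n ℕ.+ m) then g (n ℕ.+ m) else 0ℚ)
      ≡⟨ cong₂ _+_ (sumTo-cong n (λ y _ → cong (λ e → if e then g y else 0ℚ) (A-leaf-spine {y = y} n≤x x<N)))
                   (sumTo-zero b (λ m _ → cong (λ e → if e then g (n ℕ.+ m) else 0ℚ) (A-leaf-leaf n≤x (ℕ.m≤m+n n m)))) ⟩
    sumTo n (λ y → if y ≡ᵇ hub then g y else 0ℚ) + 0ℚ
      ≡⟨ +-identityʳ _ ⟩
    sumTo n (λ y → if y ≡ᵇ hub then g y else 0ℚ)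
      ≡⟨ sumTo-indicator n hub g (ℕ.m<n⇒m<1+n hub<u) ⟩
    g hub ∎
    where
    open ≡-Reasoning
    g : ℕ → ℚ
    g = ℕ→ℚ ∘ γ
    n≤x : n ℕ.≤ n ℕ.+ l
    n≤x = ℕ.m≤m+n n l
    x<N : n ℕ.+ l ℕ.< N
    x<N = ℕ.+-monoʳ-< n l<b

  φ : ℕ → ℚ
  φ = ℕ→ℚ ∘ potential

  -- The first-step equation at x, with neighbour sum and degree in ℕ to avoid subtraction.
  record Balanced (x : ℕ) : Set where
    field
      degree total : ℕ
      deg≡degree   : deg N A x ≡ degree
      degree≢0     : degree ≢ 0
      nbrs≡total   : nbrSum N A x φ ≡ ℕ→ℚ total
      balance      : total ℕ.+ degree ≡ degree ℕ.* potential x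

  deg≡ : ∀ x {d} → nbrSum N A x (λ _ → 1ℚ) ≡ ℕ→ℚ d → deg N A x ≡ d
  deg≡ x nbrs≡d = ℕ→ℚ-injective (trans (sym (nbrSum-one N A x)) nbrs≡d)

  leaves≡leafPotential : ∀ l → l ℕ.< b → potential (n ℕ.+ l) ≡ leafPotential
  leaves≡leafPotential l _ = potential-leaf (ℕ.m≤m+n n l)

  balanced-start : Balanced 0
  balanced-start = record
    { deg≡degree = deg≡ 0 (nbrSum-start (λ _ → 1))
    ; degree≢0   = λ ()
    ; nbrs≡total = nbrSum-start potential
    ; balance    = balance-start
    }

  balanced-interior : ∀ {i} → suc i ℕ.< u → Balanced (suc i)
  balanced-interior {i} 1+i<u = record
    { deg≡degree = deg≡ (suc i) (trans (nbrSum-interior (λ _ → 1) 1+i<u (λ _ _ → refl)) (cong ℕ→ℚ (2+L (leavesAt (suc i)))))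
    ; degree≢0   = λ ()
    ; nbrs≡total = nbrSum-interior potential 1+i<u leaves≡leafPotential
    ; balance    = balance-interior 1+i<u
    }
    where
    2+L : ∀ L → 1 ℕ.+ 1 ℕ.+ L ℕ.* 1 ≡ suc (suc L)
    2+L L = cong (λ x → suc (suc x)) (ℕ.*-identityʳ L)

  balanced-leaf : ∀ {l} → l ℕ.< b → Balanced (n ℕ.+ l)
  balanced-leaf {l} l<b = record
    { deg≡degree = deg≡ (n ℕ.+ l) (nbrSum-leaf (λ _ → 1) l<b)
    ; degree≢0   = λ ()
    ; nbrs≡total = nbrSum-leaf potential l<b
    ; balance    = balance-leaf l
    }

  balanced : ∀ x → x ℕ.< N → x ≢ u → Balanced x
  balanced x x<N x≢u with x ℕ.<? n
  ... | yes x<n = on-spine x (ℕ.≤∧≢⇒< (ℕ.≤-pred x<n) x≢u)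
    where
    on-spine : ∀ x → x ℕ.< u → Balanced x
    on-spine zero    _     = balanced-start
    on-spine (suc i) 1+i<u = balanced-interior 1+i<u
  ... | no  x≮n = subst Balanced (ℕ.m+[n∸m]≡n n≤x) (balanced-leaf (subst (x ∸ n ℕ.<_) (ℕ.m+n∸m≡n n b) (ℕ.∸-monoˡ-< x<N n≤x)))
    where
    n≤x : n ℕ.≤ x
    n≤x = ℕ.≮⇒≥ x≮n

  deg≢0 : ∀ (x : Fin N) → toℕ x ≢ u → deg N A (toℕ x) ≢ 0
  deg≢0 x x≢u deg≡0 = degree≢0 (trans (sym deg≡degree) deg≡0)
    where open Balanced (balanced (toℕ x) (toℕ<n x) x≢u)

  harmonic : ∀ (x : Fin N) → toℕ x ≢ u → nbrSum N A (toℕ x) φ ≡ ℕ→ℚ (deg N A (toℕ x)) * (φ (toℕ x) - 1ℚ)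
  harmonic x x≢u = begin
    nbrSum N A (toℕ x) φ                      ≡⟨ nbrs≡total ⟩
    ℕ→ℚ total                                 ≡⟨ s+d≡d*p⇒s≡d*[p-1] {total} {degree} {potential (toℕ x)} balance ⟩
    ℕ→ℚ degree * (φ (toℕ x) - 1ℚ)             ≡⟨ cong (λ d → ℕ→ℚ d * (φ (toℕ x) - 1ℚ)) deg≡degree ⟨
    ℕ→ℚ (deg N A (toℕ x)) * (φ (toℕ x) - 1ℚ)  ∎
    where
    open ≡-Reasoning
    open Balanced (balanced (toℕ x) (toℕ<n x) x≢u)

  hittingTime : ∀ {j} → j ℕ.< N → HittingTimeIs N A j u (ℕ→ℚ (potential j))
  hittingTime {j} = PotentialMethod.hittingTime N A u φ (suc (crossingPrimitive u)) deg≢0 harmonic φ[u]≡0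
    (λ x → 0≤ℕ→ℚ (potential (toℕ x))) (λ x → ℕ→ℚ-mono-≤ (potential-bounded (toℕ x))) j
    where
    φ[u]≡0 : φ u ≡ 0ℚ
    φ[u]≡0 = cong ℕ→ℚ (trans (potential-spine (ℕ.n<1+n u)) spinePotential-target)

  hittingTime-spine : ∀ {j z} → j ℕ.< u → ℤ.+ potential j ≡ z → HittingTimeIs N A j u (ℤ→ℚ z)
  hittingTime-spine j<u refl = hittingTime (ℕ.<-≤-trans (ℕ.m<n⇒m<1+n j<u) (ℕ.m≤m+n n b))

open import Data.Nat using (_≤_; _<_; _∸_; zero; s≤s)
import Data.Nat.Properties as ℕ
open import Data.Integer using (+_; _+_; _-_; _*_)
import Data.Integer.Properties as ℤ
open import Data.Integer.Tactic.RingSolver using (solve-∀)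
open import Data.Product using (_×_; _,_)
open import Relation.Binary.PropositionalEquality

+crossingPrimitive≡ : ∀ b x y → + (x ℕ.* x ℕ.+ 2 ℕ.* b ℕ.* y) ≡ + x * + x + + 2 * + b * + y
+crossingPrimitive≡ b x y = begin
  + (x ℕ.* x ℕ.+ 2 ℕ.* b ℕ.* y)     ≡⟨ ℤ.pos-+ (x ℕ.* x) (2 ℕ.* b ℕ.* y) ⟩
  + (x ℕ.* x) + + (2 ℕ.* b ℕ.* y)   ≡⟨ cong₂ _+_ (ℤ.pos-* x x) (trans (ℤ.pos-* (2 ℕ.* b) y) (cong (_* + y) (ℤ.pos-* 2 b))) ⟩
  + x * + x + + 2 * + b * + y       ∎
  where open ≡-Reasoning

p+X≡Y⇒p≡Y-X : ∀ {p} j h u b → p ℕ.+ (j ℕ.* j ℕ.+ 2 ℕ.* b ℕ.* h) ≡ u ℕ.* u ℕ.+ 2 ℕ.* b ℕ.* u →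
  + p ≡ (+ u * + u + + 2 * + b * + u) - (+ j * + j + + 2 * + b * + h)
p+X≡Y⇒p≡Y-X {p} j h u b eq = begin
  + p                                     ≡⟨ add-sub (+ p) (+ j * + j + + 2 * + b * + h) ⟩
  + p + (+ j * + j + + 2 * + b * + h) - (+ j * + j + + 2 * + b * + h)
                                          ≡⟨ cong (λ z → z - (+ j * + j + + 2 * + b * + h)) sums ⟩
  (+ u * + u + + 2 * + b * + u) - (+ j * + j + + 2 * + b * + h) ∎
  where
  open ≡-Reasoning
  add-sub : ∀ p x → p ≡ p + x - x
  add-sub = solve-∀
  sums : + p + (+ j * + j + + 2 * + b * + h) ≡ + u * + u + + 2 * + b * + u
  sums = trans (cong (_+_ (+ p)) (sym (+crossingPrimitive≡ b j h)))
        (trans (sym (ℤ.pos-+ p (j ℕ.* j ℕ.+ 2 ℕ.* b ℕ.* h))) (trans (cong +_ eq) (+crossingPrimitive≡ b u u)))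

below-hub-formula : ∀ {p} j h u b → p ℕ.+ (j ℕ.* j ℕ.+ 2 ℕ.* b ℕ.* h) ≡ u ℕ.* u ℕ.+ 2 ℕ.* b ℕ.* u →
  + p ≡ (+ suc u) * (+ suc u) - (+ suc h) * (+ suc h) + (+ 2) * ((+ b) - (+ 1)) * ((+ suc u) - (+ suc h))
        + ((+ suc h) - (+ 1)) * ((+ suc h) - (+ 1)) - ((+ suc j) - (+ 1)) * ((+ suc j) - (+ 1))
below-hub-formula j h u b eq = trans (p+X≡Y⇒p≡Y-X j h u b eq) (identity (+ j) (+ h) (+ u) (+ b))
  where
  identity : ∀ J H U B → (U * U + + 2 * B * U) - (J * J + + 2 * B * H)
    ≡ (+ 1 + U) * (+ 1 + U) - (+ 1 + H) * (+ 1 + H) + (+ 2) * (B - (+ 1)) * ((+ 1 + U) - (+ 1 + H))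
      + ((+ 1 + H) - (+ 1)) * ((+ 1 + H) - (+ 1)) - ((+ 1 + J) - (+ 1)) * ((+ 1 + J) - (+ 1))
  identity = solve-∀

above-hub-formula : ∀ {p} j u b → p ℕ.+ (j ℕ.* j ℕ.+ 2 ℕ.* b ℕ.* j) ≡ u ℕ.* u ℕ.+ 2 ℕ.* b ℕ.* u →
  + p ≡ (+ suc u) * (+ suc u) - (+ suc j) * (+ suc j) + (+ 2) * ((+ b) - (+ 1)) * ((+ suc u) - (+ suc j))
above-hub-formula j u b eq = trans (p+X≡Y⇒p≡Y-X j j u b eq) (identity (+ j) (+ u) (+ b))
  where
  identity : ∀ J U B → (U * U + + 2 * B * U) - (J * J + + 2 * B * J)
    ≡ (+ 1 + U) * (+ 1 + U) - (+ 1 + J) * (+ 1 + J) + (+ 2) * (B - (+ 1)) * ((+ 1 + U) - (+ 1 + J))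
  identity = solve-∀

theorem5 : (n k b i : ℕ) → 3 ≤ n → 2 ≤ k → k ≤ n ∸ 1 → 1 ≤ b →
    ((1 ≤ i → i ≤ k ∸ 1 →
       HittingTimeIs (Tsize n b) (Tadj n k b) (spine i) (spine n)
         (ℤ→ℚ ((+ n) * (+ n) - (+ k) * (+ k) + (+ 2) * ((+ b) - (+ 1)) * ((+ n) - (+ k))
               + ((+ k) - (+ 1)) * ((+ k) - (+ 1)) - ((+ i) - (+ 1)) * ((+ i) - (+ 1)))))
    × (k ≤ i → i ≤ n ∸ 1 →
       HittingTimeIs (Tsize n b) (Tadj n k b) (spine i) (spine n)
         (ℤ→ℚ ((+ n) * (+ n) - (+ i) * (+ i) + (+ 2) * ((+ b) - (+ 1)) * ((+ n) - (+ i))))))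
theorem5 _ _ b zero _ (s≤s _) _ _ = (λ ()) , (λ ())
theorem5 (suc u) (suc hub) b (suc j) (s≤s _) (s≤s 0<hub) hub<u _ =
    (λ _ j<hub → hittingTime-spine (ℕ.<-trans j<hub hub<u)
                   (below-hub-formula j hub u b (potential-below-hub (ℕ.<⇒≤ j<hub))))
  , (λ { (s≤s hub≤j) j<u → hittingTime-spine j<u
                   (above-hub-formula j u b (potential-above-hub hub≤j (ℕ.<⇒≤ j<u))) })
  where open TreeHittingTimes u hub b 0<hub hub<u
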